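{- Let $(S,\preceq)$ be a finite meet-semilattice (every two elements have a greatest lower bound $\sqcap$). Let $(x,\alpha)$ and $(y,\beta)$ be two pseudo-elements over $S$ that are both in canonical form. Then $\updownarrow\!(x,\alpha)=\ \updownarrow\!(y,\beta)$ if and only if $x=y$ and $\alpha=\beta$.
   Context: For $L\subseteq S$, $\downarrow\! L=\{s'\in S\mid \exists s\in L,\ s'\preceq s\}$. An antichain is a set of pairwise $\preceq$-incomparable elements. A pseudo-element is a pair $(x,\alpha)$ with $x\in S$ and $\alpha\subseteq S$ an antichain such that $x\notin\ \downarrow\!\alpha$; its pseudo-closure is $\updownarrow\!(x,\alpha)=\{s\in S\mid s\preceq x,\ s\notin\ \downarrow\!\alpha\}$. A pseudo-element $(x,\alpha)$ is in canonical form if $a\preceq x$ for every $a\in\alpha$. -}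

module Defs where

open import Level using (0ℓ)
open import Data.Nat using (ℕ)
open import Data.Fin using (Fin)
open import Data.Fin.Subset using (Subset; _∈_)
open import Data.Product using (∃; _×_)
open import Relation.Nullary using (¬_)
open import Relation.Unary using (Pred)
open import Relation.Binary.Core using (Rel)
open import Relation.Binary.PropositionalEquality using (_≡_)

-- The finite set S is represented as Fin n (with propositional equality),
-- subsets of S as Data.Fin.Subset.  The order _≤_ is a parameter.
module _ {n : ℕ} (_≤_ : Rel (Fin n) 0ℓ) where

  Down : Subset n → Pred (Fin n) 0ℓ
  Down L s' = ∃ λ s → s ∈ L × s' ≤ s

  Antichain : Subset n → Set
  Antichain α = ∀ a b → a ∈ α → b ∈ α → a ≤ b → a ≡ b

  IsPseudoElement : Fin n → Subset n → Set
  IsPseudoElement x α = Antichain α × ¬ Down α x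

  PseudoClosure : Fin n → Subset n → Pred (Fin n) 0ℓ
  PseudoClosure x α s = s ≤ x × ¬ Down α s

  Canonical : Fin n → Subset n → Set
  Canonical x α = ∀ a → a ∈ α → a ≤ x

-- The top x is the maximum of the closure, so equal closures have equal tops.
-- With a common top x, an element of ↓α below x lies outside the closure, hence
-- (double-negation-)in ↓β; for a ∈ α this gives a ≤ b ∈ β and then b ≤ c ∈ α,
-- and since α is an antichain a = c, forcing a = b ∈ β.
module Submission where

open import Defs
open import Level using (0ℓ)
open import Data.Nat using (ℕ)
open import Data.Fin using (Fin)
open import Data.Fin.Subset using (Subset; _∈_; _⊆_)
open import Data.Fin.Subset.Properties using (_∈?_; ⊆-antisym)
open import Data.Product using (_×_; _,_; proj₁; proj₂)
open import Function.Bundles using (_⇔_; mk⇔)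
open import Relation.Nullary using (¬_)
open import Relation.Nullary.Decidable using (decidable-stable)
open import Relation.Unary using (_≐_)
open import Relation.Unary.Properties using (≐-refl; ≐-sym)
open import Relation.Binary.Core using (Rel)
open import Relation.Binary.Definitions using (Decidable)
open import Relation.Binary.Structures using (IsPartialOrder)
open import Relation.Binary.PropositionalEquality using (_≡_; refl; sym; subst)
open import Relation.Binary.Lattice.Structures using (IsMeetSemilattice)

module PseudoElements {n : ℕ} {_≤_ : Rel (Fin n) 0ℓ}
                      (isPartialOrder : IsPartialOrder _≡_ _≤_) where

  open IsPartialOrder isPartialOrder using (antisym; trans) renaming (refl to ≤-refl)

  ∈⇒Down : ∀ {α a} → a ∈ α → Down _≤_ α a
  ∈⇒Down {a = a} a∈α = a , a∈α , ≤-refl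

  top∈PseudoClosure : ∀ {x α} → ¬ Down _≤_ α x → PseudoClosure _≤_ x α x
  top∈PseudoClosure x∉↓α = ≤-refl , x∉↓α

  PseudoClosure-≐⇒top-≡ : ∀ {x y α β} → ¬ Down _≤_ α x → ¬ Down _≤_ β y →
                          PseudoClosure _≤_ x α ≐ PseudoClosure _≤_ y β → x ≡ y
  PseudoClosure-≐⇒top-≡ x∉↓α y∉↓β (⊆ , ⊇) =
    antisym (proj₁ (⊆ (top∈PseudoClosure x∉↓α))) (proj₁ (⊇ (top∈PseudoClosure y∉↓β)))

  PseudoClosure-≐⇒¬¬Down : ∀ {x α β s} → PseudoClosure _≤_ x α ≐ PseudoClosure _≤_ x β →
                           s ≤ x → Down _≤_ α s → ¬ ¬ Down _≤_ β s
  PseudoClosure-≐⇒¬¬Down (_ , ⊇) s≤x s∈↓α s∉↓β = proj₂ (⊇ (s≤x , s∉↓β)) s∈↓α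

  Antichain-squeeze : ∀ {α a b c} → Antichain _≤_ α → a ∈ α → c ∈ α →
                      a ≤ b → b ≤ c → a ≡ b
  Antichain-squeeze {a = a} {b} {c} anti a∈α c∈α a≤b b≤c =
    antisym a≤b (subst (b ≤_) (sym a≡c) b≤c)
    where
    a≡c : a ≡ c
    a≡c = anti a c a∈α c∈α (trans a≤b b≤c)

  PseudoClosure-≐⇒⊆ : ∀ {x α β} → Antichain _≤_ α → Canonical _≤_ x α → Canonical _≤_ x β →
                      PseudoClosure _≤_ x α ≐ PseudoClosure _≤_ x β → α ⊆ β
  PseudoClosure-≐⇒⊆ {β = β} anti canα canβ α≐β {a} a∈α =
    decidable-stable (a ∈? β) λ a∉β →
      PseudoClosure-≐⇒¬¬Down α≐β (canα a a∈α) (∈⇒Down a∈α) λ { (b , b∈β , a≤b) →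
      PseudoClosure-≐⇒¬¬Down (≐-sym α≐β) (canβ b b∈β) (∈⇒Down b∈β) λ { (c , c∈α , b≤c) →
      a∉β (subst (_∈ β) (sym (Antichain-squeeze anti a∈α c∈α a≤b b≤c)) b∈β) } }

  PseudoClosure-≐⇔≡ : ∀ {x y α β} → IsPseudoElement _≤_ x α → IsPseudoElement _≤_ y β →
                      Canonical _≤_ x α → Canonical _≤_ y β →
                      (PseudoClosure _≤_ x α ≐ PseudoClosure _≤_ y β) ⇔ (x ≡ y × α ≡ β)
  PseudoClosure-≐⇔≡ {x} {y} {α} {β} (antiα , x∉↓α) (antiβ , y∉↓β) canα canβ = mk⇔ to from
    where
    to : PseudoClosure _≤_ x α ≐ PseudoClosure _≤_ y β → x ≡ y × α ≡ β
    to α≐β with refl ← PseudoClosure-≐⇒top-≡ x∉↓α y∉↓β α≐β =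
      refl , ⊆-antisym (PseudoClosure-≐⇒⊆ antiα canα canβ α≐β)
                       (PseudoClosure-≐⇒⊆ antiβ canβ canα (≐-sym α≐β))

    from : x ≡ y × α ≡ β → PseudoClosure _≤_ x α ≐ PseudoClosure _≤_ y β
    from (refl , refl) = ≐-refl

corollary1 : (n : ℕ) (_≤_ : Rel (Fin n) 0ℓ) (_⊓_ : Fin n → Fin n → Fin n)
             → IsMeetSemilattice _≡_ _≤_ _⊓_
             → Decidable _≤_
             → (x y : Fin n) (α β : Subset n)
             → IsPseudoElement _≤_ x α → IsPseudoElement _≤_ y β
             → Canonical _≤_ x α → Canonical _≤_ y β
             → (PseudoClosure _≤_ x α ≐ PseudoClosure _≤_ y β) ⇔ (x ≡ y × α ≡ β)
corollary1 _ _ _ isMeetSemilattice _ _ _ _ _ =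
  PseudoElements.PseudoClosure-≐⇔≡ (IsMeetSemilattice.isPartialOrder isMeetSemilattice)
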